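{- Let $n\geq0$, $k\geq1$ and $1\leq j\leq k$. Then $\vdash_{L_n^k}\circ^j\alpha\leftrightarrow\circ^j\neg\alpha$ for every formula $\alpha$.
   Context: Formulas are built from propositional variables using unary $\neg,\circ$ and binary $\land,\lor,\to$; $\circ^0\alpha=\alpha$, $\circ^{m+1}\alpha=\circ\circ^m\alpha$, $\alpha\leftrightarrow\beta:=(\alpha\to\beta)\land(\beta\to\alpha)$. Logics are Hilbert calculi with modus ponens as only rule and axiom schemas. mbC has the positive classical axioms $\alpha\to(\beta\to\alpha)$; $(\alpha\to\beta)\to((\alpha\to(\beta\to\gamma))\to(\alpha\to\gamma))$; $\alpha\to(\beta\to(\alpha\land\beta))$; $(\alpha\land\beta)\to\alpha$; $(\alpha\land\beta)\to\beta$; $\alpha\to(\alpha\lor\beta)$; $\beta\to(\alpha\lor\beta)$; $(\alpha\to\gamma)\to((\beta\to\gamma)\to((\alpha\lor\beta)\to\gamma))$; $\alpha\lor(\alpha\to\beta)$; plus $\alpha\lor\neg\alpha$ and $\circ\alpha\to(\alpha\to(\neg\alpha\to\beta))$. mbCciw = mbC + $\circ\alpha\lor(\alpha\land\neg\alpha)$. $L_n^0$ = mbCciw + $\circ^{n+2}\alpha$; $L_n^1$ = $L_n^0$ + $\neg\neg\alpha\leftrightarrow\alpha$; for $k\ge 2$, $L_n^k$ = $L_n^1$ + (ip$^j$) $\neg\circ^j\neg\alpha\leftrightarrow\neg\circ^j\alpha$ for all $1\leq j<k$. -}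

module Defs where

open import Data.Nat using (ℕ; zero; suc; _+_; _≤_; _<_)

data Formula : Set where
  var  : ℕ → Formula
  ¬'_  : Formula → Formula
  ∘'_  : Formula → Formula
  _∧'_ : Formula → Formula → Formula
  _∨'_ : Formula → Formula → Formula
  _⇒_  : Formula → Formula → Formula

infixr 6 _∧'_
infixr 5 _∨'_
infixr 4 _⇒_
infixr 3 _⇔'_

∘^ : ℕ → Formula → Formula
∘^ zero    α = α
∘^ (suc m) α = ∘' (∘^ m α)

_⇔'_ : Formula → Formula → Formula
α ⇔' β = (α ⇒ β) ∧' (β ⇒ α)

-- Axiom schemas of L_n^k (parameters n and k).
-- L_n^0 = mbCciw + ∘^(n+2) α ; L_n^1 adds ¬¬α ↔ α ;
-- L_n^k (k ≥ 2) adds (ip^j) for all 1 ≤ j < k.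
data Axiom (n k : ℕ) : Formula → Set where
  ax1  : ∀ α β → Axiom n k (α ⇒ (β ⇒ α))
  ax2  : ∀ α β γ → Axiom n k ((α ⇒ β) ⇒ ((α ⇒ (β ⇒ γ)) ⇒ (α ⇒ γ)))
  ax3  : ∀ α β → Axiom n k (α ⇒ (β ⇒ (α ∧' β)))
  ax4  : ∀ α β → Axiom n k ((α ∧' β) ⇒ α)
  ax5  : ∀ α β → Axiom n k ((α ∧' β) ⇒ β)
  ax6  : ∀ α β → Axiom n k (α ⇒ (α ∨' β))
  ax7  : ∀ α β → Axiom n k (β ⇒ (α ∨' β))
  ax8  : ∀ α β γ → Axiom n k ((α ⇒ γ) ⇒ ((β ⇒ γ) ⇒ ((α ∨' β) ⇒ γ)))
  ax9  : ∀ α β → Axiom n k (α ∨' (α ⇒ β))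
  ax10 : ∀ α → Axiom n k (α ∨' (¬' α))
  bc1  : ∀ α β → Axiom n k ((∘' α) ⇒ (α ⇒ ((¬' α) ⇒ β)))
  ciw  : ∀ α → Axiom n k ((∘' α) ∨' (α ∧' (¬' α)))
  cons : ∀ α → Axiom n k (∘^ (n + 2) α)
  dneg : 1 ≤ k → ∀ α → Axiom n k ((¬' (¬' α)) ⇔' α)
  ip   : ∀ j → 1 ≤ j → j < k → ∀ α →
         Axiom n k ((¬' (∘^ j (¬' α))) ⇔' (¬' (∘^ j α)))

data ⊢[_,_]_ (n k : ℕ) : Formula → Set where
  axiom : ∀ {φ} → Axiom n k φ → ⊢[ n , k ] φ
  mp    : ∀ {φ ψ} → ⊢[ n , k ] φ → ⊢[ n , k ] (φ ⇒ ψ) → ⊢[ n , k ] ψ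

{-# OPTIONS --safe #-}
module Submission where

-- By ciw and bc1, ∘β ⇒ ∘γ is derivable as soon as (γ ∧ ¬γ) ⇒ (β ∧ ¬β) is, so
-- ∘β ⇔ ∘γ follows from (β ∧ ¬β) ⇔ (γ ∧ ¬γ). Writing C(β) for β ∧ ¬β, one shows
-- C(∘^m α) ⇔ C(∘^m ¬α) for all m < k by induction: for m = 0 it is a
-- rearrangement of α ∧ ¬α using ¬¬α ⇔ α, and for 0 < m < k it combines the
-- induction hypothesis (through ∘, giving ∘^m α ⇔ ∘^m ¬α) with (ip^m). One more
-- application of ∘ gives the theorem for j = m + 1.

open import Defs
open import Data.Nat using (ℕ; zero; suc; _≤_; _<_; s≤s; z≤n)
open import Data.Nat.Properties using (<⇒≤)
open import Data.List using (List; []; _∷_)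
open import Data.List.Membership.Propositional using (_∈_)
open import Data.List.Relation.Unary.Any using (here; there)
open import Relation.Binary.PropositionalEquality using (refl)

contradictory : Formula → Formula
contradictory α = α ∧' ¬' α

module Deduction (n k : ℕ) where

  infix 2 _⊢_

  data _⊢_ (Γ : List Formula) : Formula → Set where
    hyp : ∀ {φ} → φ ∈ Γ → Γ ⊢ φ
    ax  : ∀ {φ} → Axiom n k φ → Γ ⊢ φ
    mp  : ∀ {φ ψ} → Γ ⊢ φ → Γ ⊢ φ ⇒ ψ → Γ ⊢ ψ

  toHilbert : ∀ {φ} → [] ⊢ φ → ⊢[ n , k ] φ
  toHilbert (hyp ())
  toHilbert (ax a)   = axiom a
  toHilbert (mp d e) = mp (toHilbert d) (toHilbert e)

  assumption : ∀ {Γ A} → A ∷ Γ ⊢ A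
  assumption = hyp (here refl)

  weaken : ∀ {Γ A φ} → Γ ⊢ φ → A ∷ Γ ⊢ φ
  weaken (hyp p)  = hyp (there p)
  weaken (ax a)   = ax a
  weaken (mp d e) = mp (weaken d) (weaken e)

  ⇒-refl : ∀ {Γ} A → Γ ⊢ A ⇒ A
  ⇒-refl A = mp (ax (ax1 A (A ⇒ A))) (mp (ax (ax1 A A)) (ax (ax2 A (A ⇒ A) A)))

  deduction : ∀ {Γ A B} → A ∷ Γ ⊢ B → Γ ⊢ A ⇒ B
  deduction {A = A} (hyp (here refl)) = ⇒-refl A
  deduction {A = A} (hyp (there p))   = mp (hyp p) (ax (ax1 _ A))
  deduction         (ax a)            = mp (ax a) (ax (ax1 _ _))
  deduction         (mp d e)          = mp (deduction e) (mp (deduction d) (ax (ax2 _ _ _)))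

  ⇒-trans : ∀ {Γ A B C} → Γ ⊢ A ⇒ B → Γ ⊢ B ⇒ C → Γ ⊢ A ⇒ C
  ⇒-trans f g = deduction (mp (mp assumption (weaken f)) (weaken g))

  ∧-intro : ∀ {Γ A B} → Γ ⊢ A → Γ ⊢ B → Γ ⊢ A ∧' B
  ∧-intro p q = mp q (mp p (ax (ax3 _ _)))

  ∧-elimˡ : ∀ {Γ A B} → Γ ⊢ A ∧' B → Γ ⊢ A
  ∧-elimˡ p = mp p (ax (ax4 _ _))

  ∧-elimʳ : ∀ {Γ A B} → Γ ⊢ A ∧' B → Γ ⊢ B
  ∧-elimʳ p = mp p (ax (ax5 _ _))

  ∨-elim : ∀ {Γ A B C} → Γ ⊢ A ∨' B → A ∷ Γ ⊢ C → B ∷ Γ ⊢ C → Γ ⊢ C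
  ∨-elim {A = A} {B} {C} d e f = mp d (mp (deduction f) (mp (deduction e) (ax (ax8 A B C))))

  ⇔-refl : ∀ {Γ} A → Γ ⊢ A ⇔' A
  ⇔-refl A = ∧-intro (⇒-refl A) (⇒-refl A)

  ⇔-sym : ∀ {Γ A B} → Γ ⊢ A ⇔' B → Γ ⊢ B ⇔' A
  ⇔-sym p = ∧-intro (∧-elimʳ p) (∧-elimˡ p)

  ⇔-trans : ∀ {Γ A B C} → Γ ⊢ A ⇔' B → Γ ⊢ B ⇔' C → Γ ⊢ A ⇔' C
  ⇔-trans p q = ∧-intro (⇒-trans (∧-elimˡ p) (∧-elimˡ q)) (⇒-trans (∧-elimʳ q) (∧-elimʳ p))

  ∧-swap : ∀ {Γ A B} → Γ ⊢ A ∧' B ⇒ B ∧' A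
  ∧-swap = deduction (∧-intro (∧-elimʳ assumption) (∧-elimˡ assumption))

  ∧-comm : ∀ {Γ A B} → Γ ⊢ A ∧' B ⇔' B ∧' A
  ∧-comm = ∧-intro ∧-swap ∧-swap

  ∧-map : ∀ {Γ A A′ B B′} → Γ ⊢ A ⇒ A′ → Γ ⊢ B ⇒ B′ → Γ ⊢ A ∧' B ⇒ A′ ∧' B′
  ∧-map f g = deduction (∧-intro (mp (∧-elimˡ assumption) (weaken f))
                                 (mp (∧-elimʳ assumption) (weaken g)))

  ∧-cong : ∀ {Γ A A′ B B′} → Γ ⊢ A ⇔' A′ → Γ ⊢ B ⇔' B′ → Γ ⊢ A ∧' B ⇔' A′ ∧' B′
  ∧-cong p q = ∧-intro (∧-map (∧-elimˡ p) (∧-elimˡ q)) (∧-map (∧-elimʳ p) (∧-elimʳ q))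

  contradictory-¬ : ∀ {Γ α} → Γ ⊢ ¬' ¬' α ⇔' α → Γ ⊢ contradictory α ⇔' contradictory (¬' α)
  contradictory-¬ {α = α} ¬¬α⇔α = ⇔-trans ∧-comm (∧-cong (⇔-refl (¬' α)) (⇔-sym ¬¬α⇔α))

  ∘-antitone : ∀ {Γ β γ} → Γ ⊢ contradictory γ ⇒ contradictory β → Γ ⊢ ∘' β ⇒ ∘' γ
  ∘-antitone {Γ} {β} {γ} f =
    deduction (∨-elim (ax (ciw γ)) assumption
      (mp (∧-elimʳ contradictoryβ) (mp (∧-elimˡ contradictoryβ)
        (mp (weaken assumption) (ax (bc1 β (∘' γ)))))))
    where
    contradictoryβ : contradictory γ ∷ ∘' β ∷ Γ ⊢ contradictory β
    contradictoryβ = mp assumption (weaken (weaken f))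

  ∘-cong : ∀ {Γ β γ} → Γ ⊢ contradictory β ⇔' contradictory γ → Γ ⊢ ∘' β ⇔' ∘' γ
  ∘-cong p = ∧-intro (∘-antitone (∧-elimʳ p)) (∘-antitone (∧-elimˡ p))

  contradictory-∘^-¬ : ∀ {Γ} α m → m < k →
                       Γ ⊢ contradictory (∘^ m α) ⇔' contradictory (∘^ m (¬' α))
  contradictory-∘^-¬ α zero    0<k   = contradictory-¬ (ax (dneg 0<k α))
  contradictory-∘^-¬ α (suc m) 1+m<k =
    ∧-cong (∘-cong (contradictory-∘^-¬ α m (<⇒≤ 1+m<k)))
           (⇔-sym (ax (ip (suc m) (s≤s z≤n) 1+m<k α)))

theorem26 : (n k j : ℕ) → 1 ≤ k → 1 ≤ j → j ≤ k → (α : Formula) →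
              ⊢[ n , k ] ((∘^ j α) ⇔' (∘^ j (¬' α)))
theorem26 n k (suc m) _ _ 1+m≤k α = toHilbert (∘-cong (contradictory-∘^-¬ α m 1+m≤k))
  where open Deduction n k
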